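{- Let $f$ and $g$ be distinct elements of a matroid $M$ such that $f$ is freer than $g$ in $M$. Then (i) $b(f;M)\geq b(g;M)$; (ii) $W_k(f;M)\geq W_k(g;M)$ for all $k\geq 0$, provided $g$ is not a loop of $M$; (iii) $h(f;M)\geq h(g;M)$, provided $g$ is not a loop of $M$; (iv) $\gamma(f;M)\geq \gamma(g;M)$, provided $f$ is not a coloop of $M$.
   Context: For distinct elements $f,g$ of a matroid $M$, $f$ is freer than $g$ if $g$ is contained in the closure of every circuit of $M$ that contains $f$. For an element $e$ of $M$: $b(e;M)$ is the number of bases of $M$ containing $e$; $W_k(e;M)$ is the number of rank-$k$ flats of $M$ containing $e$; $h(e;M)$ is the number of hyperplanes of $M$ containing $e$; $\gamma(e;M)$ is the number of circuits of $M$ containing $e$. -}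

module Defs where

open import Data.Nat using (ℕ; zero; suc; _<_; _⊔_; _≡ᵇ_; _+_; _∸_)
open import Data.Bool using (Bool; true; false; T; _∧_; not; if_then_else_)
open import Data.Fin using (Fin)
open import Data.Fin.Subset using (Subset; ⊥; ⊤; ⁅_⁆; _∈_; _∉_; _⊆_; _∪_; ∣_∣)
open import Data.Fin.Subset.Properties using (_⊆?_; _⊂?_)
open import Data.Vec using (Vec; []; _∷_; lookup; tabulate)
open import Data.Vec.Properties using (≡-dec)
open import Data.List using (List; []; _∷_; map; _++_; foldr; allFin)
open import Data.Product using (Σ; ∃-syntax; _×_)
open import Relation.Nullary.Decidable using (⌊_⌋)
open import Relation.Binary.PropositionalEquality using (_≡_)
import Data.Bool.Properties as BP

subsets : (n : ℕ) → List (Subset n)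
subsets zero = [] ∷ []
subsets (suc n) = map (true ∷_) (subsets n) ++ map (false ∷_) (subsets n)

countSubsets : ∀ {n} → (Subset n → Bool) → ℕ
countSubsets {n} p = foldr (λ X c → if p X then suc c else c) 0 (subsets n)

allSubsets : ∀ {n} → (Subset n → Bool) → Bool
allSubsets {n} p = foldr (λ X acc → p X ∧ acc) true (subsets n)

allElems : ∀ {n} → (Fin n → Bool) → Bool
allElems {n} p = foldr (λ x acc → p x ∧ acc) true (allFin n)

_⊆ᵇ_ : ∀ {n} → Subset n → Subset n → Bool
X ⊆ᵇ Y = ⌊ X ⊆? Y ⌋

_⊂ᵇ_ : ∀ {n} → Subset n → Subset n → Bool
X ⊂ᵇ Y = ⌊ X ⊂? Y ⌋

_==ˢ_ : ∀ {n} → Subset n → Subset n → Bool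
X ==ˢ Y = ⌊ ≡-dec BP._≟_ X Y ⌋

_⇒ᵇ_ : Bool → Bool → Bool
a ⇒ᵇ b = not a Data.Bool.∨ b

record Matroid (n : ℕ) : Set where
  field
    indep      : Subset n → Bool
    indep-⊥    : T (indep ⊥)
    indep-⊆    : ∀ {I J} → J ⊆ I → T (indep I) → T (indep J)
    indep-aug  : ∀ {I J} → T (indep I) → T (indep J) → ∣ I ∣ < ∣ J ∣ →
                 ∃[ x ] (x ∈ J × x ∉ I × T (indep (I ∪ ⁅ x ⁆)))

module _ {n : ℕ} (M : Matroid n) where
  open Matroid M

  rank : Subset n → ℕ
  rank X = foldr (λ I m → (if indep I ∧ (I ⊆ᵇ X) then ∣ I ∣ else 0) ⊔ m) 0 (subsets n)

  r : ℕ
  r = rank ⊤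

  cl : Subset n → Subset n
  cl X = tabulate (λ x → rank (X ∪ ⁅ x ⁆) ≡ᵇ rank X)

  isBasis : Subset n → Bool
  isBasis B = indep B ∧ allElems (λ x → not (lookup B x) ⇒ᵇ not (indep (B ∪ ⁅ x ⁆)))

  isCircuit : Subset n → Bool
  isCircuit C = not (indep C) ∧ allSubsets (λ D → (D ⊂ᵇ C) ⇒ᵇ indep D)

  isFlat : Subset n → Bool
  isFlat F = cl F ==ˢ F

  isHyperplane : Subset n → Bool
  isHyperplane H = isFlat H ∧ (suc (rank H) ≡ᵇ r)

  b : Fin n → ℕ
  b e = countSubsets (λ B → isBasis B ∧ lookup B e)

  W : ℕ → Fin n → ℕ
  W k e = countSubsets (λ F → isFlat F ∧ (rank F ≡ᵇ k) ∧ lookup F e)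

  h : Fin n → ℕ
  h e = countSubsets (λ H → isHyperplane H ∧ lookup H e)

  γ : Fin n → ℕ
  γ e = countSubsets (λ C → isCircuit C ∧ lookup C e)

  IsLoop : Fin n → Set
  IsLoop e = T (not (indep ⁅ e ⁆))

  IsColoop : Fin n → Set
  IsColoop e = ∀ B → T (isBasis B) → e ∈ B

  Freer : Fin n → Fin n → Set
  Freer f g = ∀ C → T (isCircuit C) → f ∈ C → g ∈ cl C

{-# OPTIONS --safe #-}

-- Each inequality comes from an injection from the members of the family that contain g into
-- those that contain f: a member containing both is fixed, and a member X with g ∈ X, f ∉ X
-- goes to a member Y with f ∈ Y, g ∉ Y from which X can be recovered.
-- Freeness is used through one exchange property: if X ∪ {g} is independent and f, g ∉ X, then
-- so is X ∪ {f}, because a circuit C of X ∪ {f} contains f but not g, and g ∈ cl C would make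
-- (C - f) ∪ {g} ⊆ X ∪ {g} dependent.
-- A basis X goes to (X - g) ∪ {f}. A flat F goes to Y = cl ((Z - g) ∪ {f}) for a basis Z of F
-- through g (which needs g not to be a loop); Y has the rank of F, and F = cl ((Y - f) ∪ {g}).
-- A circuit C goes to the circuit D of K ∪ {f}, where K ⊇ C - g is a basis of E - f (so
-- K ∪ {f} is dependent when f is not a coloop); C is the unique circuit of K ∪ {g}, and it lies
-- in (D - f) ∪ {g}.

module Submission where

open import Defs
open import Data.Bool using (Bool; true; false; T; _∧_; not; if_then_else_)
open import Data.Bool.Properties using (T-∧; T-≡; ∧-assoc)
import Data.Bool.Properties as Bool
open import Data.Fin using (Fin; zero; suc; _≟_)
open import Data.Fin.Subset using (Subset; inside; outside; ⊥; ⊤; ⁅_⁆; _∈_; _∉_; _⊆_; _⊂_; _∪_; _─_; _-_; ∣_∣; ∁)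
open import Data.Fin.Subset.Properties
  using ( anySubset?; _∈?_; _⊆?_; _⊂?_; ∈⊤; ∉⊥; ⊆⊤; ∣⊥∣≡0; ⊆-antisym; ∪-identityʳ; p─⊥≡p; p─q⊆p
        ; p⊂q⇒p⊆q; p⊂q⇒∣p∣<∣q∣; p⊂q⇒∁p⊃∁q; x∈p∪q⁻; x∈p∪q⁺; x∈⁅x⁆; x∈⁅y⁆⇒x≡y; x∈p∧x≢y⇒x∈p-y; x∈p⇒p-x⊂p)
open import Data.List using (List; []; _∷_; _++_; map; foldr; length; filterᵇ; allFin)
open import Data.List.Membership.Propositional using () renaming (_∈_ to _∈ˡ_)
open import Data.List.Membership.Propositional.Properties
  using (∈-map⁺; ∈-map⁻; ∈-++⁺ˡ; ∈-++⁺ʳ; ∈-++⁻; ∈-∃++; ∈-filter⁺; ∈-filter⁻; ∈-allFin)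
open import Data.List.Properties using (length-++)
open import Data.List.Relation.Unary.All as All using ([]; _∷_)
open import Data.List.Relation.Unary.AllPairs using ([]; _∷_)
open import Data.List.Relation.Unary.Any as Any using ()
open import Data.List.Relation.Unary.Unique.Propositional using (Unique)
import Data.List.Relation.Unary.Unique.Propositional.Properties as Unique
open import Data.Nat using (ℕ; zero; suc; _≤_; _<_; _≥_; _⊔_; _≡ᵇ_; z≤n; s≤s; _<?_)
open import Data.Nat.Induction using (<-wellFounded)
open import Data.Nat.Properties
  using ( +-suc; ≤-trans; ≤-antisym; ≮⇒≥; <⇒≱; n≮n; n<1+n; suc-injective
        ; m≤m⊔n; m≤n⊔m; ⊔-sel; ≡ᵇ⇒≡; ≡⇒≡ᵇ; module ≤-Reasoning)
open import Data.Product using (∃-syntax; _×_; _,_; proj₁; proj₂)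
open import Data.Sum as Sum using (_⊎_; inj₁; inj₂)
open import Data.Vec using ([]; _∷_; here; there; lookup)
open import Data.Vec.Properties using ([]=⇒lookup; lookup⇒[]=; lookup∘tabulate; ≡-dec)
open import Function using (_∘_; _on_; _⇔_; mk⇔; Equivalence)
open import Induction.WellFounded using (Acc; acc)
open import Relation.Binary.Construct.On using () renaming (wellFounded to on-wellFounded)
open import Relation.Binary.PropositionalEquality
  using (_≡_; _≢_; refl; sym; trans; cong; subst; subst₂; module ≡-Reasoning)
open import Relation.Nullary using (¬_; yes; no; contradiction)
open import Relation.Nullary.Decidable using (T?; ¬?; _×-dec_; decidable-stable; toWitness; fromWitness)
open import Relation.Unary using (Decidable)

private
  variable
    n : ℕ

subsets-complete : ∀ {n} (X : Subset n) → X ∈ˡ subsets n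
subsets-complete [] = Any.here refl
subsets-complete {suc n} (true ∷ X) = ∈-++⁺ˡ (∈-map⁺ (true ∷_) (subsets-complete X))
subsets-complete {suc n} (false ∷ X) =
  ∈-++⁺ʳ (map (true ∷_) (subsets n)) (∈-map⁺ (false ∷_) (subsets-complete X))

subsets-unique : ∀ n → Unique (subsets n)
subsets-unique zero = [] ∷ []
subsets-unique (suc n) =
  Unique.++⁺ (Unique.map⁺ ∷-injectiveʳ (subsets-unique n)) (Unique.map⁺ ∷-injectiveʳ (subsets-unique n))
             disjoint
  where
  ∷-injectiveʳ : ∀ {b} {X Y : Subset n} → _≡_ {A = Subset (suc n)} (b ∷ X) (b ∷ Y) → X ≡ Y
  ∷-injectiveʳ refl = refl
  disjoint : ∀ {X} → ¬ (X ∈ˡ map (true ∷_) (subsets n) × X ∈ˡ map (false ∷_) (subsets n))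
  disjoint (X∈ , X∈′) with ∈-map⁻ (true ∷_) X∈ | ∈-map⁻ (false ∷_) X∈′
  ... | _ , _ , refl | _ , _ , ()

T-not⁻ : ∀ {b} → T (not b) → ¬ T b
T-not⁻ {false} _ ()

T-not⁺ : ∀ {b} → ¬ T b → T (not b)
T-not⁺ {false} _   = _
T-not⁺ {true}  ¬tt = ¬tt _

T-⇒ᵇ⁻ : ∀ {a b} → T (a ⇒ᵇ b) → T a → T b
T-⇒ᵇ⁻ {true} tb _ = tb

T-⇒ᵇ⁺ : ∀ {a b} → (T a → T b) → T (a ⇒ᵇ b)
T-⇒ᵇ⁺ {false} _ = _
T-⇒ᵇ⁺ {true}  h = h _

T-foldr-∧⁻ : ∀ {A : Set} (p : A → Bool) {xs x} → T (foldr (λ y acc → p y ∧ acc) true xs) → x ∈ˡ xs → T (p x)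
T-foldr-∧⁻ p {y ∷ _} t (Any.here refl)  = proj₁ (Equivalence.to (T-∧ {p y}) t)
T-foldr-∧⁻ p {y ∷ _} t (Any.there x∈xs) = T-foldr-∧⁻ p (proj₂ (Equivalence.to (T-∧ {p y}) t)) x∈xs

T-foldr-∧⁺ : ∀ {A : Set} (p : A → Bool) xs → (∀ x → T (p x)) → T (foldr (λ y acc → p y ∧ acc) true xs)
T-foldr-∧⁺ p []       _  = _
T-foldr-∧⁺ p (y ∷ ys) all = Equivalence.from (T-∧ {p y}) (all y , T-foldr-∧⁺ p ys all)

T-allSubsets⇔ : ∀ {p : Subset n → Bool} → T (allSubsets p) ⇔ (∀ X → T (p X))
T-allSubsets⇔ {p = p} = mk⇔ (λ t X → T-foldr-∧⁻ p t (subsets-complete X)) (T-foldr-∧⁺ p (subsets _))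

T-allElems⇔ : ∀ {p : Fin n → Bool} → T (allElems p) ⇔ (∀ x → T (p x))
T-allElems⇔ {p = p} = mk⇔ (λ t x → T-foldr-∧⁻ p t (∈-allFin x)) (T-foldr-∧⁺ p (allFin _))

T-lookup⇔∈ : ∀ {X : Subset n} {x} → T (lookup X x) ⇔ x ∈ X
T-lookup⇔∈ = mk⇔ (λ t → lookup⇒[]= _ _ (Equivalence.to T-≡ t)) (λ x∈X → Equivalence.from T-≡ ([]=⇒lookup x∈X))

T-∧-lookup⇔ : ∀ {b} {X : Subset n} {x} → T (b ∧ lookup X x) ⇔ (T b × x ∈ X)
T-∧-lookup⇔ {b = b} = mk⇔
  (λ t → let tb , tx = Equivalence.to (T-∧ {b}) t in tb , Equivalence.to T-lookup⇔∈ tx)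
  (λ (tb , x∈X) → Equivalence.from (T-∧ {b}) (tb , Equivalence.from T-lookup⇔∈ x∈X))

-- Counting subsets

length-≤-by-injection : ∀ {A B : Set} (R : A → B → Set) {xs : List A} {ys : List B} →
  Unique xs → (∀ {x} → x ∈ˡ xs → ∃[ y ] y ∈ˡ ys × R x y) →
  (∀ {x₁ x₂ y} → R x₁ y → R x₂ y → x₁ ≡ x₂) → length xs ≤ length ys
length-≤-by-injection R [] image injective = z≤n
length-≤-by-injection R {x ∷ xs} (x∉xs ∷ unique) image injective
  with y , y∈ys , Rxy ← image (Any.here refl)
  with as , bs , refl ← ∈-∃++ y∈ys
  = subst (suc (length xs) ≤_) (sym length-as++y∷bs)
      (s≤s (length-≤-by-injection R unique image′ injective))
  where
  length-as++y∷bs : length (as ++ y ∷ bs) ≡ suc (length (as ++ bs))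
  length-as++y∷bs = trans (length-++ as) (trans (+-suc (length as) (length bs)) (cong suc (sym (length-++ as))))
  image′ : ∀ {x′} → x′ ∈ˡ xs → ∃[ y′ ] y′ ∈ˡ as ++ bs × R x′ y′
  image′ x′∈xs with y′ , y′∈ys , Rx′y′ ← image (Any.there x′∈xs) with ∈-++⁻ as y′∈ys
  ... | inj₁ y′∈as             = y′ , ∈-++⁺ˡ y′∈as , Rx′y′
  ... | inj₂ (Any.there y′∈bs) = y′ , ∈-++⁺ʳ as y′∈bs , Rx′y′
  ... | inj₂ (Any.here refl)   = contradiction (injective Rxy Rx′y′) (All.lookup x∉xs x′∈xs)

countSubsets≡length-filter : ∀ {n} (p : Subset n → Bool) → countSubsets p ≡ length (filterᵇ p (subsets n))
countSubsets≡length-filter {n} p = go (subsets n)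
  where
  go : ∀ Xs → foldr (λ X c → if p X then suc c else c) 0 Xs ≡ length (filterᵇ p Xs)
  go [] = refl
  go (X ∷ Xs) with p X
  ... | true  = cong suc (go Xs)
  ... | false = go Xs

countSubsets-≤-by-injection : ∀ {n} {p q : Subset n → Bool} (R : Subset n → Subset n → Set) →
  (∀ X → T (q X) → ∃[ Y ] T (p Y) × R X Y) → (∀ {X₁ X₂ Y} → R X₁ Y → R X₂ Y → X₁ ≡ X₂) →
  countSubsets q ≤ countSubsets p
countSubsets-≤-by-injection {n} {p} {q} R image injective
  rewrite countSubsets≡length-filter p | countSubsets≡length-filter q =
  length-≤-by-injection R (Unique.filter⁺ (T? ∘ q) (subsets-unique n)) image′ injective
  where
  image′ : ∀ {X} → X ∈ˡ filterᵇ q (subsets n) → ∃[ Y ] Y ∈ˡ filterᵇ p (subsets n) × R X Y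
  image′ {X} X∈ with _ , qX ← ∈-filter⁻ (T? ∘ q) {xs = subsets n} X∈ with Y , pY , RXY ← image X qX =
    Y , ∈-filter⁺ (T? ∘ p) (subsets-complete Y) pY , RXY

countSubsets-cong : ∀ {n} {p q : Subset n → Bool} → (∀ X → p X ≡ q X) → countSubsets p ≡ countSubsets q
countSubsets-cong {n} {p} {q} p≗q = go (subsets n)
  where
  go : ∀ Xs → foldr (λ X c → if p X then suc c else c) 0 Xs ≡ foldr (λ X c → if q X then suc c else c) 0 Xs
  go [] = refl
  go (X ∷ Xs) rewrite p≗q X = cong (λ c → if q X then suc c else c) (go Xs)

count∋ : (Subset n → Bool) → Fin n → ℕ
count∋ 𝓕 e = countSubsets (λ X → 𝓕 X ∧ lookup X e)

count∋-≤ : ∀ {𝓕 : Subset n → Bool} {f g} (P : Subset n → Subset n → Set) →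
  (∀ {X₁ X₂ Y} → T (𝓕 Y) → f ∈ Y → g ∉ Y → P X₁ Y → P X₂ Y → X₁ ≡ X₂) →
  (∀ {X} → T (𝓕 X) → g ∈ X → f ∉ X → ∃[ Y ] T (𝓕 Y) × f ∈ Y × g ∉ Y × P X Y) →
  count∋ 𝓕 g ≤ count∋ 𝓕 f
count∋-≤ {n} {𝓕} {f} {g} P P-injective transfer = countSubsets-≤-by-injection R image R-injective
  where
  -- Images of the first kind contain g and those of the second do not, so they never collide.
  R : Subset n → Subset n → Set
  R X Y = (g ∈ Y × X ≡ Y) ⊎ (T (𝓕 Y) × f ∈ Y × g ∉ Y × P X Y)
  image : ∀ X → T (𝓕 X ∧ lookup X g) → ∃[ Y ] T (𝓕 Y ∧ lookup Y f) × R X Y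
  image X X∈𝓕∋g with X∈𝓕 , g∈X ← Equivalence.to (T-∧-lookup⇔ {b = 𝓕 X}) X∈𝓕∋g with f ∈? X
  ... | yes f∈X = X , Equivalence.from (T-∧-lookup⇔ {b = 𝓕 X}) (X∈𝓕 , f∈X) , inj₁ (g∈X , refl)
  ... | no  f∉X with Y , Y∈𝓕 , f∈Y , g∉Y , PXY ← transfer X∈𝓕 g∈X f∉X =
    Y , Equivalence.from (T-∧-lookup⇔ {b = 𝓕 Y}) (Y∈𝓕 , f∈Y) , inj₂ (Y∈𝓕 , f∈Y , g∉Y , PXY)
  R-injective : ∀ {X₁ X₂ Y} → R X₁ Y → R X₂ Y → X₁ ≡ X₂
  R-injective (inj₁ (_ , refl))              (inj₁ (_ , refl))         = refl
  R-injective (inj₁ (g∈Y , _))               (inj₂ (_ , _ , g∉Y , _))  = contradiction g∈Y g∉Y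
  R-injective (inj₂ (_ , _ , g∉Y , _))       (inj₁ (g∈Y , _))          = contradiction g∈Y g∉Y
  R-injective (inj₂ (Y∈𝓕 , f∈Y , g∉Y , P₁)) (inj₂ (_ , _ , _ , P₂)) = P-injective Y∈𝓕 f∈Y g∉Y P₁ P₂

x∈p∪⁅y⁆⁻ : ∀ {x y} (p : Subset n) → x ∈ p ∪ ⁅ y ⁆ → x ∈ p ⊎ x ≡ y
x∈p∪⁅y⁆⁻ {y = y} p x∈ = Sum.map₂ (x∈⁅y⁆⇒x≡y y) (x∈p∪q⁻ p ⁅ y ⁆ x∈)

x∈p⇒x∈p∪⁅y⁆ : ∀ {x y} {p : Subset n} → x ∈ p → x ∈ p ∪ ⁅ y ⁆
x∈p⇒x∈p∪⁅y⁆ x∈p = x∈p∪q⁺ (inj₁ x∈p)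

y∈p∪⁅y⁆ : ∀ {y} {p : Subset n} → y ∈ p ∪ ⁅ y ⁆
y∈p∪⁅y⁆ {y = y} = x∈p∪q⁺ (inj₂ (x∈⁅x⁆ y))

x∈p─q⇒x∉q : ∀ {x} (p q : Subset n) → x ∈ p ─ q → x ∉ q
x∈p─q⇒x∉q (s ∷ p) (outside ∷ q) here ()
x∈p─q⇒x∉q (s ∷ p) (t ∷ q) (there x∈p─q) (there x∈q) = x∈p─q⇒x∉q p q x∈p─q x∈q

x∈p-y⇒x∈p : ∀ {x y} {p : Subset n} → x ∈ p - y → x ∈ p
x∈p-y⇒x∈p {y = y} {p} = p─q⊆p p ⁅ y ⁆

x∈p-y⇒x≢y : ∀ {x y} {p : Subset n} → x ∈ p - y → x ≢ y
x∈p-y⇒x≢y {x = x} {p = p} x∈p-x refl = x∈p─q⇒x∉q p ⁅ x ⁆ x∈p-x (x∈⁅x⁆ x)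

∣p∪⁅x⁆∣≡1+∣p∣ : ∀ {x} (p : Subset n) → x ∉ p → ∣ p ∪ ⁅ x ⁆ ∣ ≡ suc ∣ p ∣
∣p∪⁅x⁆∣≡1+∣p∣ {x = zero}  (inside ∷ p)  x∉p = contradiction here x∉p
∣p∪⁅x⁆∣≡1+∣p∣ {x = zero}  (outside ∷ p) x∉p = cong (suc ∘ ∣_∣) (∪-identityʳ p)
∣p∪⁅x⁆∣≡1+∣p∣ {x = suc x} (inside ∷ p)  x∉p = cong suc (∣p∪⁅x⁆∣≡1+∣p∣ p (x∉p ∘ there))
∣p∪⁅x⁆∣≡1+∣p∣ {x = suc x} (outside ∷ p) x∉p = ∣p∪⁅x⁆∣≡1+∣p∣ p (x∉p ∘ there)

∣p-x∣+1≡∣p∣ : ∀ {x} (p : Subset n) → x ∈ p → suc ∣ p - x ∣ ≡ ∣ p ∣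
∣p-x∣+1≡∣p∣ {x = zero}  (inside ∷ p)  here          = cong (suc ∘ ∣_∣) (p─⊥≡p p)
∣p-x∣+1≡∣p∣ {x = suc x} (inside ∷ p)  (there x∈p) = cong suc (∣p-x∣+1≡∣p∣ p x∈p)
∣p-x∣+1≡∣p∣ {x = suc x} (outside ∷ p) (there x∈p) = ∣p-x∣+1≡∣p∣ p x∈p

p⊆q∧x∈q⇒p∪⁅x⁆⊆q : ∀ {x} {p q : Subset n} → p ⊆ q → x ∈ q → p ∪ ⁅ x ⁆ ⊆ q
p⊆q∧x∈q⇒p∪⁅x⁆⊆q {p = p} p⊆q x∈q y∈ with x∈p∪⁅y⁆⁻ p y∈
... | inj₁ y∈p  = p⊆q y∈p
... | inj₂ refl = x∈q

x∉p∪⁅y⁆ : ∀ {x y} {p : Subset n} → x ∉ p → x ≢ y → x ∉ p ∪ ⁅ y ⁆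
x∉p∪⁅y⁆ {p = p} x∉p x≢y x∈ = Sum.[ x∉p , x≢y ] (x∈p∪⁅y⁆⁻ p x∈)

p⊆q⇒p∪⁅x⁆⊆q∪⁅x⁆ : ∀ {x} {p q : Subset n} → p ⊆ q → p ∪ ⁅ x ⁆ ⊆ q ∪ ⁅ x ⁆
p⊆q⇒p∪⁅x⁆⊆q∪⁅x⁆ p⊆q = p⊆q∧x∈q⇒p∪⁅x⁆⊆q (x∈p⇒x∈p∪⁅y⁆ ∘ p⊆q) y∈p∪⁅y⁆

p∪⁅x⁆∪⁅y⁆⊆p∪⁅y⁆∪⁅x⁆ : ∀ {x y} {p : Subset n} → (p ∪ ⁅ x ⁆) ∪ ⁅ y ⁆ ⊆ (p ∪ ⁅ y ⁆) ∪ ⁅ x ⁆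
p∪⁅x⁆∪⁅y⁆⊆p∪⁅y⁆∪⁅x⁆ =
  p⊆q∧x∈q⇒p∪⁅x⁆⊆q (p⊆q∧x∈q⇒p∪⁅x⁆⊆q (x∈p⇒x∈p∪⁅y⁆ ∘ x∈p⇒x∈p∪⁅y⁆) y∈p∪⁅y⁆) (x∈p⇒x∈p∪⁅y⁆ y∈p∪⁅y⁆)

p⊆q∪⁅x⁆⇒p-x⊆q : ∀ {x} {p q : Subset n} → p ⊆ q ∪ ⁅ x ⁆ → p - x ⊆ q
p⊆q∪⁅x⁆⇒p-x⊆q {q = q} p⊆ y∈p-x with x∈p∪⁅y⁆⁻ q (p⊆ (x∈p-y⇒x∈p y∈p-x))
... | inj₁ y∈q  = y∈q
... | inj₂ refl = contradiction refl (x∈p-y⇒x≢y y∈p-x)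

p⊆q∪⁅x⁆∧x∉p⇒p⊆q : ∀ {x} {p q : Subset n} → p ⊆ q ∪ ⁅ x ⁆ → x ∉ p → p ⊆ q
p⊆q∪⁅x⁆∧x∉p⇒p⊆q {q = q} p⊆ x∉p y∈p with x∈p∪⁅y⁆⁻ q (p⊆ y∈p)
... | inj₁ y∈q  = y∈q
... | inj₂ refl = contradiction y∈p x∉p

p∪⁅x⁆-x≡p : ∀ {x} (p : Subset n) → x ∉ p → p ∪ ⁅ x ⁆ - x ≡ p
p∪⁅x⁆-x≡p {x = zero}  (inside ∷ p)  x∉p = contradiction here x∉p
p∪⁅x⁆-x≡p {x = zero}  (outside ∷ p) x∉p = cong (outside ∷_) (trans (p─⊥≡p (p ∪ ⊥)) (∪-identityʳ p))
p∪⁅x⁆-x≡p {x = suc x} (inside ∷ p)  x∉p = cong (inside ∷_) (p∪⁅x⁆-x≡p p (x∉p ∘ there))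
p∪⁅x⁆-x≡p {x = suc x} (outside ∷ p) x∉p = cong (outside ∷_) (p∪⁅x⁆-x≡p p (x∉p ∘ there))

p-x∪⁅x⁆≡p : ∀ {x} (p : Subset n) → x ∈ p → (p - x) ∪ ⁅ x ⁆ ≡ p
p-x∪⁅x⁆≡p {x = zero}  (inside ∷ p)  here        = cong (inside ∷_) (trans (∪-identityʳ (p ─ ⊥)) (p─⊥≡p p))
p-x∪⁅x⁆≡p {x = suc x} (inside ∷ p)  (there x∈p) = cong (inside ∷_) (p-x∪⁅x⁆≡p p x∈p)
p-x∪⁅x⁆≡p {x = suc x} (outside ∷ p) (there x∈p) = cong (outside ∷_) (p-x∪⁅x⁆≡p p x∈p)

p⊆q∧∣q∣≤∣p∣⇒q⊆p : ∀ {p q : Subset n} → p ⊆ q → ∣ q ∣ ≤ ∣ p ∣ → q ⊆ p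
p⊆q∧∣q∣≤∣p∣⇒q⊆p {p = p} p⊆q ∣q∣≤∣p∣ {x} x∈q with x ∈? p
... | yes x∈p = x∈p
... | no  x∉p = contradiction ∣q∣≤∣p∣ (<⇒≱ (p⊂q⇒∣p∣<∣q∣ (p⊆q , x , x∈q , x∉p)))

module _ {n ℓ} {P : Subset n → Set ℓ} (P? : Decidable P) (μ : Subset n → ℕ) where

  minimise : ∀ {X} → P X → ∃[ Y ] P Y × ∀ {Z} → P Z → μ Y ≤ μ Z
  minimise {X} = go X (on-wellFounded μ <-wellFounded X)
    where
    go : ∀ X → Acc (_<_ on μ) X → P X → ∃[ Y ] P Y × ∀ {Z} → P Z → μ Y ≤ μ Z
    go X (acc smaller) PX with anySubset? (λ Y → P? Y ×-dec μ Y <? μ X)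
    ... | yes (Y , PY , μY<μX) = go Y (smaller μY<μX) PY
    ... | no  ∄smaller         = X , PX , λ PZ → ≮⇒≥ (λ μZ<μX → ∄smaller (_ , PZ , μZ<μX))

module _ {A : Set} (w : A → ℕ) where

  foldr-⊔-upper : ∀ {x xs} → x ∈ˡ xs → w x ≤ foldr (λ y m → w y ⊔ m) 0 xs
  foldr-⊔-upper (Any.here refl) = m≤m⊔n _ _
  foldr-⊔-upper {xs = y ∷ _} (Any.there x∈xs) = ≤-trans (foldr-⊔-upper x∈xs) (m≤n⊔m (w y) _)

  foldr-⊔-elim : (P : ℕ → Set) → P 0 → (∀ x → P (w x)) → ∀ xs → P (foldr (λ y m → w y ⊔ m) 0 xs)
  foldr-⊔-elim P P0 Pw []       = P0
  foldr-⊔-elim P P0 Pw (y ∷ ys) with ⊔-sel (w y) (foldr (λ y m → w y ⊔ m) 0 ys)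
  ... | inj₁ ≡wy   = subst P (sym ≡wy) (Pw y)
  ... | inj₂ ≡rest = subst P (sym ≡rest) (foldr-⊔-elim P P0 Pw ys)

-- Rank, bases, closure and circuits

module MatroidProperties {n : ℕ} (M : Matroid n) where
  open Matroid M

  Independent : Subset n → Set
  Independent X = T (indep X)

  independent? : Decidable Independent
  independent? X = T? (indep X)

  record IsBasisOf (I X : Subset n) : Set where
    constructor isBasisOf
    field
      independent : Independent I
      included    : I ⊆ X
      card≡rank   : ∣ I ∣ ≡ rank M X

  open IsBasisOf public

  ∣I∣≤rank : ∀ {I X} → Independent I → I ⊆ X → ∣ I ∣ ≤ rank M X
  ∣I∣≤rank {I} {X} I-ind I⊆X = subst (_≤ rank M X) (if-chosen I-chosen) (foldr-⊔-upper _ (subsets-complete I))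
    where
    I-chosen : T (indep I ∧ (I ⊆ᵇ X))
    I-chosen = Equivalence.from (T-∧ {indep I}) (I-ind , fromWitness {a? = I ⊆? X} I⊆X)
    if-chosen : ∀ {b} → T b → (if b then ∣ I ∣ else 0) ≡ ∣ I ∣
    if-chosen {true} _ = refl

  basisOf-exists : ∀ X → ∃[ I ] IsBasisOf I X
  basisOf-exists X = toBasisOf (foldr-⊔-elim _ Attained ∅-attains attains (subsets n))
    where
    Attained : ℕ → Set
    Attained m = ∃[ I ] Independent I × I ⊆ X × ∣ I ∣ ≡ m
    ∅-attains : Attained 0
    ∅-attains = ⊥ , indep-⊥ , (λ x∈⊥ → contradiction x∈⊥ ∉⊥) , ∣⊥∣≡0 n
    attains : ∀ J → Attained (if indep J ∧ (J ⊆ᵇ X) then ∣ J ∣ else 0)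
    attains J with indep J ∧ (J ⊆ᵇ X) in chosen
    ... | true  = let J-ind , J⊆X = Equivalence.to (T-∧ {indep J}) (subst T (sym chosen) _)
                  in J , J-ind , toWitness {a? = J ⊆? X} J⊆X , refl
    ... | false = ∅-attains
    toBasisOf : Attained (rank M X) → ∃[ I ] IsBasisOf I X
    toBasisOf (I , I-ind , I⊆X , ∣I∣≡rank) = I , isBasisOf I-ind I⊆X ∣I∣≡rank

  basisOf⇒maximal : ∀ {I X z} → IsBasisOf I X → z ∈ X → z ∉ I → ¬ Independent (I ∪ ⁅ z ⁆)
  basisOf⇒maximal {I} {X} {z} I-basis z∈X z∉I Iz-ind = n≮n ∣ I ∣ (begin-strict
    ∣ I ∣          <⟨ n<1+n ∣ I ∣ ⟩
    suc ∣ I ∣      ≡⟨ sym (∣p∪⁅x⁆∣≡1+∣p∣ I z∉I) ⟩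
    ∣ I ∪ ⁅ z ⁆ ∣  ≤⟨ ∣I∣≤rank Iz-ind (p⊆q∧x∈q⇒p∪⁅x⁆⊆q (included I-basis) z∈X) ⟩
    rank M X       ≡⟨ sym (card≡rank I-basis) ⟩
    ∣ I ∣          ∎)
    where open ≤-Reasoning

  maximal⇒basisOf : ∀ {I X} → Independent I → I ⊆ X →
    (∀ {z} → z ∈ X → z ∉ I → ¬ Independent (I ∪ ⁅ z ⁆)) → IsBasisOf I X
  maximal⇒basisOf {I} {X} I-ind I⊆X maximal with J , J-basis ← basisOf-exists X =
    isBasisOf I-ind I⊆X (≤-antisym (∣I∣≤rank I-ind I⊆X) (subst (_≤ ∣ I ∣) (card≡rank J-basis) (≮⇒≥ ∣I∣≮∣J∣)))
    where
    ∣I∣≮∣J∣ : ¬ ∣ I ∣ < ∣ J ∣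
    ∣I∣≮∣J∣ ∣I∣<∣J∣ with z , z∈J , z∉I , Iz-ind ← indep-aug I-ind (independent J-basis) ∣I∣<∣J∣ =
      maximal (included J-basis z∈J) z∉I Iz-ind

  extend-to-basisOf : ∀ {I X} → Independent I → I ⊆ X → ∃[ B ] I ⊆ B × IsBasisOf B X
  extend-to-basisOf {I} {X} I-ind I⊆X
    with B , (B-ind , I⊆B , B⊆X) , B-minimum
           ← minimise (λ B → independent? B ×-dec I ⊆? B ×-dec B ⊆? X) (∣_∣ ∘ ∁) (I-ind , (λ x∈I → x∈I) , I⊆X)
    = B , I⊆B , maximal⇒basisOf B-ind B⊆X B-maximal
    where
    -- B has the smallest complement among the candidates, so no candidate strictly contains it.
    B-maximal : ∀ {z} → z ∈ X → z ∉ B → ¬ Independent (B ∪ ⁅ z ⁆)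
    B-maximal z∈X z∉B Bz-ind =
      <⇒≱ (p⊂q⇒∣p∣<∣q∣ (p⊂q⇒∁p⊃∁q (x∈p⇒x∈p∪⁅y⁆ , _ , y∈p∪⁅y⁆ , z∉B)))
          (B-minimum (Bz-ind , x∈p⇒x∈p∪⁅y⁆ ∘ I⊆B , p⊆q∧x∈q⇒p∪⁅x⁆⊆q B⊆X z∈X))

  basisOf-restrict : ∀ {I X Y} → IsBasisOf I X → I ⊆ Y → Y ⊆ X → IsBasisOf I Y
  basisOf-restrict I-basis I⊆Y Y⊆X =
    maximal⇒basisOf (independent I-basis) I⊆Y (basisOf⇒maximal I-basis ∘ Y⊆X)

  independent⇒basisOf-self : ∀ {I} → Independent I → IsBasisOf I I
  independent⇒basisOf-self I-ind = maximal⇒basisOf I-ind (λ x∈I → x∈I) (λ z∈I z∉I → contradiction z∈I z∉I)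

  ∣X∣≤rank⇒independent : ∀ {X} → ∣ X ∣ ≤ rank M X → Independent X
  ∣X∣≤rank⇒independent {X} ∣X∣≤rank with I , I-basis ← basisOf-exists X =
    indep-⊆ (p⊆q∧∣q∣≤∣p∣⇒q⊆p (included I-basis) (subst (∣ X ∣ ≤_) (sym (card≡rank I-basis)) ∣X∣≤rank))
            (independent I-basis)

  ∈cl⇒rank≡ : ∀ {x X} → x ∈ cl M X → rank M (X ∪ ⁅ x ⁆) ≡ rank M X
  ∈cl⇒rank≡ {x} x∈cl = ≡ᵇ⇒≡ _ _ (subst T (lookup∘tabulate _ x) (Equivalence.from T-lookup⇔∈ x∈cl))

  rank≡⇒∈cl : ∀ {x X} → rank M (X ∪ ⁅ x ⁆) ≡ rank M X → x ∈ cl M X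
  rank≡⇒∈cl {x} rank≡ = Equivalence.to T-lookup⇔∈ (subst T (sym (lookup∘tabulate _ x)) (≡⇒≡ᵇ _ _ rank≡))

  ∈cl⇒dependent : ∀ {I X x} → IsBasisOf I X → x ∈ cl M X → x ∉ I → ¬ Independent (I ∪ ⁅ x ⁆)
  ∈cl⇒dependent {I} {X} {x} I-basis x∈cl = basisOf⇒maximal I-basis-of-X∪x y∈p∪⁅y⁆
    where
    I-basis-of-X∪x : IsBasisOf I (X ∪ ⁅ x ⁆)
    I-basis-of-X∪x = isBasisOf (independent I-basis) (x∈p⇒x∈p∪⁅y⁆ ∘ included I-basis)
                               (trans (card≡rank I-basis) (sym (∈cl⇒rank≡ x∈cl)))

  dependent⇒∈cl : ∀ {I X x} → IsBasisOf I X → (x ∉ I → ¬ Independent (I ∪ ⁅ x ⁆)) → x ∈ cl M X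
  dependent⇒∈cl {I} {X} {x} I-basis x-dependent =
    rank≡⇒∈cl (trans (sym (card≡rank I-basis-of-X∪x)) (card≡rank I-basis))
    where
    maximal : ∀ {z} → z ∈ X ∪ ⁅ x ⁆ → z ∉ I → ¬ Independent (I ∪ ⁅ z ⁆)
    maximal z∈ with x∈p∪⁅y⁆⁻ X z∈
    ... | inj₁ z∈X = basisOf⇒maximal I-basis z∈X
    ... | inj₂ refl = x-dependent
    I-basis-of-X∪x : IsBasisOf I (X ∪ ⁅ x ⁆)
    I-basis-of-X∪x = maximal⇒basisOf (independent I-basis) (x∈p⇒x∈p∪⁅y⁆ ∘ included I-basis) maximal

  ∉cl⇒independent : ∀ {I X x} → IsBasisOf I X → x ∉ cl M X → Independent (I ∪ ⁅ x ⁆)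
  ∉cl⇒independent I-basis x∉cl =
    decidable-stable (independent? _) (λ dependent → x∉cl (dependent⇒∈cl I-basis (λ _ → dependent)))

  X⊆cl : ∀ {X} → X ⊆ cl M X
  X⊆cl {X} x∈X with I , I-basis ← basisOf-exists X = dependent⇒∈cl I-basis (basisOf⇒maximal I-basis x∈X)

  cl-mono : ∀ {X Y} → X ⊆ Y → cl M X ⊆ cl M Y
  cl-mono {X} {Y} X⊆Y x∈clX
    with I , I-basis ← basisOf-exists X
    with K , I⊆K , K-basis ← extend-to-basisOf (independent I-basis) (X⊆Y ∘ included I-basis)
    = dependent⇒∈cl K-basis λ x∉K Kx-ind →
        ∈cl⇒dependent I-basis x∈clX (x∉K ∘ I⊆K) (indep-⊆ (p⊆q⇒p∪⁅x⁆⊆q∪⁅x⁆ I⊆K) Kx-ind)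

  basisOf-cl : ∀ {I X} → IsBasisOf I X → IsBasisOf I (cl M X)
  basisOf-cl I-basis = maximal⇒basisOf (independent I-basis) (X⊆cl ∘ included I-basis) (∈cl⇒dependent I-basis)

  basisOf⇒cl≡ : ∀ {I X Y} → IsBasisOf I X → IsBasisOf I Y → cl M X ≡ cl M Y
  basisOf⇒cl≡ I-basis-X I-basis-Y =
    ⊆-antisym (dependent⇒∈cl I-basis-Y ∘ ∈cl⇒dependent I-basis-X)
              (dependent⇒∈cl I-basis-X ∘ ∈cl⇒dependent I-basis-Y)

  cl-isFlat : ∀ X → T (isFlat M (cl M X))
  cl-isFlat X with I , I-basis ← basisOf-exists X =
    fromWitness {a? = ≡-dec Bool._≟_ (cl M (cl M X)) (cl M X)} (basisOf⇒cl≡ (basisOf-cl I-basis) I-basis)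

  isFlat⇒cl≡ : ∀ {F} → T (isFlat M F) → cl M F ≡ F
  isFlat⇒cl≡ {F} = toWitness {a? = ≡-dec Bool._≟_ (cl M F) F}

  rank-cl : ∀ X → rank M (cl M X) ≡ rank M X
  rank-cl X with I , I-basis ← basisOf-exists X =
    trans (sym (card≡rank (basisOf-cl I-basis))) (card≡rank I-basis)

  rank-independent : ∀ {I} → Independent I → rank M I ≡ ∣ I ∣
  rank-independent I-ind = sym (card≡rank (independent⇒basisOf-self I-ind))

  Circuit : Subset n → Set
  Circuit C = T (isCircuit M C)

  circuit⇒dependent : ∀ {C} → Circuit C → ¬ Independent C
  circuit⇒dependent {C} C-circ = T-not⁻ (proj₁ (Equivalence.to (T-∧ {not (indep C)}) C-circ))

  circuit-minimal : ∀ {C D} → Circuit C → D ⊂ C → Independent D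
  circuit-minimal {C} {D} C-circ D⊂C =
    T-⇒ᵇ⁻ (Equivalence.to T-allSubsets⇔ (proj₂ (Equivalence.to (T-∧ {not (indep C)}) C-circ)) D)
          (fromWitness {a? = D ⊂? C} D⊂C)

  minimal-dependent⇒circuit : ∀ {C} → ¬ Independent C → (∀ {D} → D ⊂ C → Independent D) → Circuit C
  minimal-dependent⇒circuit {C} C-dep minimal = Equivalence.from (T-∧ {not (indep C)})
    (T-not⁺ C-dep , Equivalence.from T-allSubsets⇔ (λ D → T-⇒ᵇ⁺ (minimal ∘ toWitness {a? = D ⊂? C})))

  dependent⇒∃circuit : ∀ {X} → ¬ Independent X → ∃[ C ] Circuit C × C ⊆ X
  dependent⇒∃circuit {X} X-dep
    with C , (C-dep , C⊆X) , C-minimum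
           ← minimise (λ D → ¬? (independent? D) ×-dec D ⊆? X) ∣_∣ (X-dep , λ x∈X → x∈X)
    = C , minimal-dependent⇒circuit C-dep C-minimal , C⊆X
    where
    C-minimal : ∀ {D} → D ⊂ C → Independent D
    C-minimal {D} D⊂C = decidable-stable (independent? D) λ D-dep →
      <⇒≱ (p⊂q⇒∣p∣<∣q∣ D⊂C) (C-minimum (D-dep , C⊆X ∘ p⊂q⇒p⊆q D⊂C))

  dependent⊆circuit⇒≡ : ∀ {C D} → Circuit C → D ⊆ C → ¬ Independent D → D ≡ C
  dependent⊆circuit⇒≡ {C} {D} C-circ D⊆C D-dep = ⊆-antisym D⊆C C⊆D
    where
    C⊆D : C ⊆ D
    C⊆D {x} x∈C with x ∈? D
    ... | yes x∈D = x∈D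
    ... | no  x∉D = contradiction (circuit-minimal C-circ (D⊆C , x , x∈C , x∉D)) D-dep

  circuit⇒independent[C-x] : ∀ {C x} → Circuit C → x ∈ C → Independent (C - x)
  circuit⇒independent[C-x] C-circ x∈C = circuit-minimal C-circ (x∈p⇒p-x⊂p x∈C)

  circuit⊆I∪⁅x⁆⇒x∈C : ∀ {I C x} → Independent I → Circuit C → C ⊆ I ∪ ⁅ x ⁆ → x ∈ C
  circuit⊆I∪⁅x⁆⇒x∈C {x = x} I-ind C-circ C⊆ with x ∈? _
  ... | yes x∈C = x∈C
  ... | no  x∉C = contradiction (indep-⊆ (p⊆q∪⁅x⁆∧x∉p⇒p⊆q C⊆ x∉C) I-ind) (circuit⇒dependent C-circ)

  circuit⇒basisOf[C-x] : ∀ {C x} → Circuit C → x ∈ C → IsBasisOf (C - x) C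
  circuit⇒basisOf[C-x] {C} {x} C-circ x∈C = maximal⇒basisOf (circuit⇒independent[C-x] C-circ x∈C) x∈p-y⇒x∈p maximal
    where
    maximal : ∀ {z} → z ∈ C → z ∉ C - x → ¬ Independent ((C - x) ∪ ⁅ z ⁆)
    maximal {z} z∈C z∉C-x with z ≟ x
    ... | yes refl = circuit⇒dependent C-circ ∘ subst Independent (p-x∪⁅x⁆≡p C x∈C)
    ... | no  z≢x  = contradiction (x∈p∧x≢y⇒x∈p-y z∈C z≢x) z∉C-x

  circuit⇒x∈cl[C-x] : ∀ {C x} → Circuit C → x ∈ C → x ∈ cl M (C - x)
  circuit⇒x∈cl[C-x] C-circ x∈C = subst (_ ∈_)
    (basisOf⇒cl≡ (circuit⇒basisOf[C-x] C-circ x∈C) (independent⇒basisOf-self (circuit⇒independent[C-x] C-circ x∈C)))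
    (X⊆cl x∈C)

  circuit-unique : ∀ {J g C₁ C₂} → Independent J → g ∉ J → Circuit C₁ → Circuit C₂ →
    C₁ ⊆ J ∪ ⁅ g ⁆ → C₂ ⊆ J ∪ ⁅ g ⁆ → C₁ ≡ C₂
  circuit-unique {J} {g} {C₁} {C₂} J-ind g∉J C₁-circ C₂-circ C₁⊆ C₂⊆ =
    dependent⊆circuit⇒≡ C₂-circ C₁⊆C₂ (circuit⇒dependent C₁-circ)
    where
    C₁⊆C₂ : C₁ ⊆ C₂
    C₁⊆C₂ {x} x∈C₁ with x ∈? C₂
    ... | yes x∈C₂ = x∈C₂
    ... | no  x∉C₂ = contradiction (indep-⊆ C₂⊆S (∣X∣≤rank⇒independent ∣S∣≤rank)) (circuit⇒dependent C₂-circ)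
      where
      x∈J∪g : x ∈ J ∪ ⁅ g ⁆
      x∈J∪g = C₁⊆ x∈C₁
      S : Subset n
      S = (J ∪ ⁅ g ⁆) - x
      C₂⊆S : C₂ ⊆ S
      C₂⊆S y∈C₂ = x∈p∧x≢y⇒x∈p-y (C₂⊆ y∈C₂) (λ { refl → x∉C₂ y∈C₂ })
      C₁-x⊆S : C₁ - x ⊆ S
      C₁-x⊆S y∈ = x∈p∧x≢y⇒x∈p-y (C₁⊆ (x∈p-y⇒x∈p y∈)) (x∈p-y⇒x≢y y∈)
      S∪x≡J∪g : S ∪ ⁅ x ⁆ ≡ J ∪ ⁅ g ⁆
      S∪x≡J∪g = p-x∪⁅x⁆≡p (J ∪ ⁅ g ⁆) x∈J∪g
      ∣S∣≡∣J∣ : ∣ S ∣ ≡ ∣ J ∣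
      ∣S∣≡∣J∣ = suc-injective (trans (∣p-x∣+1≡∣p∣ (J ∪ ⁅ g ⁆) x∈J∪g) (∣p∪⁅x⁆∣≡1+∣p∣ J g∉J))
      open ≤-Reasoning
      -- x lies in the closure of C₁ - x ⊆ S, so adding it back does not raise the rank of S.
      ∣S∣≤rank : ∣ S ∣ ≤ rank M S
      ∣S∣≤rank = begin
        ∣ S ∣               ≡⟨ ∣S∣≡∣J∣ ⟩
        ∣ J ∣               ≤⟨ ∣I∣≤rank J-ind (subst (J ⊆_) (sym S∪x≡J∪g) x∈p⇒x∈p∪⁅y⁆) ⟩
        rank M (S ∪ ⁅ x ⁆)  ≡⟨ ∈cl⇒rank≡ (cl-mono C₁-x⊆S (circuit⇒x∈cl[C-x] C₁-circ x∈C₁)) ⟩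
        rank M S            ∎

  T-isBasis⇔ : ∀ {B} → T (isBasis M B) ⇔ (Independent B × ∀ {z} → z ∉ B → ¬ Independent (B ∪ ⁅ z ⁆))
  T-isBasis⇔ {B} = mk⇔
    (λ B-basis → let B-ind , all-unextendable = Equivalence.to (T-∧ {indep B}) B-basis in
      B-ind , λ {z} → unextendable⁻ (Equivalence.to (T-allElems⇔ {p = unextendableᵇ}) all-unextendable z))
    (λ (B-ind , B-max) → Equivalence.from (T-∧ {indep B})
      (B-ind , Equivalence.from (T-allElems⇔ {p = unextendableᵇ}) (λ _ → unextendable⁺ B-max)))
    where
    unextendableᵇ : Fin n → Bool
    unextendableᵇ z = not (lookup B z) ⇒ᵇ not (indep (B ∪ ⁅ z ⁆))
    unextendable⁻ : ∀ {z} → T (unextendableᵇ z) → z ∉ B → ¬ Independent (B ∪ ⁅ z ⁆)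
    unextendable⁻ t z∉B = T-not⁻ (T-⇒ᵇ⁻ t (T-not⁺ (z∉B ∘ Equivalence.to T-lookup⇔∈)))
    unextendable⁺ : ∀ {z} → (z ∉ B → ¬ Independent (B ∪ ⁅ z ⁆)) → T (unextendableᵇ z)
    unextendable⁺ B-max = T-⇒ᵇ⁺ λ z∉B → T-not⁺ (B-max (T-not⁻ z∉B ∘ Equivalence.from T-lookup⇔∈))

  isBasis⇔basisOf⊤ : ∀ {B} → T (isBasis M B) ⇔ IsBasisOf B ⊤
  isBasis⇔basisOf⊤ = mk⇔
    (λ B-basis → let B-ind , B-max = Equivalence.to T-isBasis⇔ B-basis in maximal⇒basisOf B-ind ⊆⊤ (λ _ → B-max))
    (λ B-basis → Equivalence.from T-isBasis⇔ (independent B-basis , basisOf⇒maximal B-basis ∈⊤))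

  ¬loop⇒independent : ∀ {x} → ¬ IsLoop M x → Independent ⁅ x ⁆
  ¬loop⇒independent ¬loop = decidable-stable (independent? _) (¬loop ∘ T-not⁺)

  ¬coloop⇒x∈cl[⊤-x] : ∀ {x} → ¬ IsColoop M x → x ∈ cl M (⊤ - x)
  ¬coloop⇒x∈cl[⊤-x] {x} ¬coloop with anySubset? (λ B → T? (isBasis M B) ×-dec ¬? (x ∈? B))
  ... | no  ∄basis∌x = contradiction every-basis∋x ¬coloop
    where
    every-basis∋x : IsColoop M x
    every-basis∋x B B-basis = decidable-stable (x ∈? B) λ x∉B → ∄basis∌x (B , B-basis , x∉B)
  ... | yes (B , B-basis , x∉B) =
    dependent⇒∈cl (basisOf-restrict B-basis⊤ B⊆⊤-x ⊆⊤) (λ _ → basisOf⇒maximal B-basis⊤ ∈⊤ x∉B)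
    where
    B-basis⊤ : IsBasisOf B ⊤
    B-basis⊤ = Equivalence.to isBasis⇔basisOf⊤ B-basis
    B⊆⊤-x : B ⊆ ⊤ - x
    B⊆⊤-x y∈B = x∈p∧x≢y⇒x∈p-y ∈⊤ (λ { refl → x∉B y∈B })

-- Freer elements

module FreerProperties {n : ℕ} (M : Matroid n) {f g : Fin n} (f≢g : f ≢ g) (f-freer : Freer M f g) where
  open Matroid M
  open MatroidProperties M

  g≢f : g ≢ f
  g≢f = f≢g ∘ sym

  freer⇒dependent : ∀ {C} → Circuit C → f ∈ C → g ∉ C → ¬ Independent ((C - f) ∪ ⁅ g ⁆)
  freer⇒dependent C-circ f∈C g∉C =
    ∈cl⇒dependent (circuit⇒basisOf[C-x] C-circ f∈C) (f-freer _ C-circ f∈C) (g∉C ∘ x∈p-y⇒x∈p)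

  freer-exchange : ∀ {X} → Independent (X ∪ ⁅ g ⁆) → f ∉ X → g ∉ X → Independent (X ∪ ⁅ f ⁆)
  freer-exchange {X} Xg-ind f∉X g∉X = decidable-stable (independent? _) (no-circuit ∘ dependent⇒∃circuit)
    where
    no-circuit : ¬ (∃[ C ] Circuit C × C ⊆ X ∪ ⁅ f ⁆)
    no-circuit (C , C-circ , C⊆Xf) =
      freer⇒dependent C-circ f∈C g∉C (indep-⊆ (p⊆q⇒p∪⁅x⁆⊆q∪⁅x⁆ (p⊆q∪⁅x⁆⇒p-x⊆q C⊆Xf)) Xg-ind)
      where
      f∈C : f ∈ C
      f∈C = circuit⊆I∪⁅x⁆⇒x∈C (indep-⊆ x∈p⇒x∈p∪⁅y⁆ Xg-ind) C-circ C⊆Xf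
      g∉C : g ∉ C
      g∉C = x∉p∪⁅y⁆ g∉X g≢f ∘ C⊆Xf

  basis-transfer : ∀ {X} → T (isBasis M X) → g ∈ X → f ∉ X →
    ∃[ Y ] T (isBasis M Y) × f ∈ Y × g ∉ Y × X ≡ (Y - f) ∪ ⁅ g ⁆
  basis-transfer {X} X-basis g∈X f∉X =
    X₀ ∪ ⁅ f ⁆ , Equivalence.from isBasis⇔basisOf⊤ Y-basis , y∈p∪⁅y⁆ , x∉p∪⁅y⁆ g∉X₀ g≢f , X≡
    where
    X₀ : Subset n
    X₀ = X - g
    f∉X₀ : f ∉ X₀
    f∉X₀ = f∉X ∘ x∈p-y⇒x∈p
    g∉X₀ : g ∉ X₀
    g∉X₀ g∈X₀ = x∈p-y⇒x≢y g∈X₀ refl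
    X₀∪g≡X : X₀ ∪ ⁅ g ⁆ ≡ X
    X₀∪g≡X = p-x∪⁅x⁆≡p X g∈X
    X-basis⊤ : IsBasisOf X ⊤
    X-basis⊤ = Equivalence.to isBasis⇔basisOf⊤ X-basis
    Y-basis : IsBasisOf (X₀ ∪ ⁅ f ⁆) ⊤
    Y-basis = isBasisOf (freer-exchange (subst Independent (sym X₀∪g≡X) (independent X-basis⊤)) f∉X₀ g∉X₀) ⊆⊤
      (trans (∣p∪⁅x⁆∣≡1+∣p∣ X₀ f∉X₀) (trans (∣p-x∣+1≡∣p∣ X g∈X) (card≡rank X-basis⊤)))
    X≡ : X ≡ (X₀ ∪ ⁅ f ⁆ - f) ∪ ⁅ g ⁆
    X≡ = trans (sym X₀∪g≡X) (cong (_∪ ⁅ g ⁆) (sym (p∪⁅x⁆-x≡p X₀ f∉X₀)))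

  module FlatTransfer {F Z} (F-flat : T (isFlat M F)) (f∉F : f ∉ F) (Z-basis : IsBasisOf Z F) (g∈Z : g ∈ Z) where

    Z₀ : Subset n
    Z₀ = Z - g

    Y : Subset n
    Y = cl M (Z₀ ∪ ⁅ f ⁆)

    private
      Z⊆F : Z ⊆ F
      Z⊆F = included Z-basis
      Z₀∪g≡Z : Z₀ ∪ ⁅ g ⁆ ≡ Z
      Z₀∪g≡Z = p-x∪⁅x⁆≡p Z g∈Z
      f∉Z₀ : f ∉ Z₀
      f∉Z₀ = f∉F ∘ Z⊆F ∘ x∈p-y⇒x∈p
      g∉Z₀ : g ∉ Z₀
      g∉Z₀ g∈Z₀ = x∈p-y⇒x≢y g∈Z₀ refl
      Z₀f-ind : Independent (Z₀ ∪ ⁅ f ⁆)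
      Z₀f-ind = freer-exchange (subst Independent (sym Z₀∪g≡Z) (independent Z-basis)) f∉Z₀ g∉Z₀
      Z₀f-basis : IsBasisOf (Z₀ ∪ ⁅ f ⁆) (Z₀ ∪ ⁅ f ⁆)
      Z₀f-basis = independent⇒basisOf-self Z₀f-ind
      ∉F⇒Z∪⁅y⁆-independent : ∀ {y} → y ∉ F → Independent (Z ∪ ⁅ y ⁆)
      ∉F⇒Z∪⁅y⁆-independent y∉F = ∉cl⇒independent Z-basis (y∉F ∘ subst (_ ∈_) (isFlat⇒cl≡ F-flat))
      Z₀∪⁅y⁆∪⁅g⁆⊆Z∪⁅y⁆ : ∀ {y} → (Z₀ ∪ ⁅ y ⁆) ∪ ⁅ g ⁆ ⊆ Z ∪ ⁅ y ⁆
      Z₀∪⁅y⁆∪⁅g⁆⊆Z∪⁅y⁆ = p⊆q∧x∈q⇒p∪⁅x⁆⊆q (p⊆q⇒p∪⁅x⁆⊆q∪⁅x⁆ x∈p-y⇒x∈p) (x∈p⇒x∈p∪⁅y⁆ g∈Z)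

    rank-Y : rank M Y ≡ rank M F
    rank-Y = begin
      rank M Y                   ≡⟨ rank-cl _ ⟩
      rank M (Z₀ ∪ ⁅ f ⁆)        ≡⟨ rank-independent Z₀f-ind ⟩
      ∣ Z₀ ∪ ⁅ f ⁆ ∣             ≡⟨ ∣p∪⁅x⁆∣≡1+∣p∣ Z₀ f∉Z₀ ⟩
      suc ∣ Z₀ ∣                 ≡⟨ ∣p-x∣+1≡∣p∣ Z g∈Z ⟩
      ∣ Z ∣                      ≡⟨ card≡rank Z-basis ⟩
      rank M F                   ∎
      where open ≡-Reasoning

    g∉Y : g ∉ Y
    g∉Y g∈Y = ∈cl⇒dependent Z₀f-basis g∈Y (x∉p∪⁅y⁆ g∉Z₀ g≢f)
      (indep-⊆ Z₀∪⁅y⁆∪⁅g⁆⊆Z∪⁅y⁆ (∉F⇒Z∪⁅y⁆-independent f∉F))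

    -- For y ∈ Y outside F, Z ∪ {y} is independent; exchanging g for f makes Z₀ ∪ {y, f}
    -- independent, contradicting y ∈ cl (Z₀ ∪ {f}).
    Y-f⊆F : Y - f ⊆ F
    Y-f⊆F {y} y∈Y-f with y ∈? F
    ... | yes y∈F = y∈F
    ... | no  y∉F = contradiction Z₀∪⁅y⁆∪⁅f⁆-ind
      (∈cl⇒dependent Z₀f-basis (x∈p-y⇒x∈p y∈Y-f) (x∉p∪⁅y⁆ (y∉F ∘ Z⊆F ∘ x∈p-y⇒x∈p) y≢f)
        ∘ indep-⊆ p∪⁅x⁆∪⁅y⁆⊆p∪⁅y⁆∪⁅x⁆)
      where
      y≢f : y ≢ f
      y≢f = x∈p-y⇒x≢y y∈Y-f
      Z₀∪⁅y⁆∪⁅f⁆-ind : Independent ((Z₀ ∪ ⁅ y ⁆) ∪ ⁅ f ⁆)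
      Z₀∪⁅y⁆∪⁅f⁆-ind = freer-exchange (indep-⊆ Z₀∪⁅y⁆∪⁅g⁆⊆Z∪⁅y⁆ (∉F⇒Z∪⁅y⁆-independent y∉F))
        (x∉p∪⁅y⁆ f∉Z₀ (y≢f ∘ sym)) (x∉p∪⁅y⁆ g∉Z₀ λ { refl → y∉F (Z⊆F g∈Z) })

    F≡cl : F ≡ cl M ((Y - f) ∪ ⁅ g ⁆)
    F≡cl = trans (sym (isFlat⇒cl≡ F-flat))
      (basisOf⇒cl≡ Z-basis (basisOf-restrict Z-basis Z⊆Y-f∪g (p⊆q∧x∈q⇒p∪⁅x⁆⊆q Y-f⊆F (Z⊆F g∈Z))))
      where
      Z⊆Y-f∪g : Z ⊆ (Y - f) ∪ ⁅ g ⁆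
      Z⊆Y-f∪g = subst (_⊆ (Y - f) ∪ ⁅ g ⁆) Z₀∪g≡Z (p⊆q⇒p∪⁅x⁆⊆q∪⁅x⁆ λ z∈Z₀ →
        x∈p∧x≢y⇒x∈p-y (X⊆cl (x∈p⇒x∈p∪⁅y⁆ z∈Z₀)) λ { refl → f∉Z₀ z∈Z₀ })

  flat-transfer : ∀ {F} → Independent ⁅ g ⁆ → T (isFlat M F) → g ∈ F → f ∉ F →
    ∃[ Y ] T (isFlat M Y) × rank M Y ≡ rank M F × f ∈ Y × g ∉ Y × F ≡ cl M ((Y - f) ∪ ⁅ g ⁆)
  flat-transfer {F} g-ind F-flat g∈F f∉F
    with Z , ⁅g⁆⊆Z , Z-basis ← extend-to-basisOf g-ind (λ x∈⁅g⁆ → subst (_∈ F) (sym (x∈⁅y⁆⇒x≡y g x∈⁅g⁆)) g∈F)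
    = Y , cl-isFlat _ , rank-Y , X⊆cl y∈p∪⁅y⁆ , g∉Y , F≡cl
    where open FlatTransfer F-flat f∉F Z-basis (⁅g⁆⊆Z (x∈⁅x⁆ g))

  circuit-transfer : f ∈ cl M (⊤ - f) → ∀ {C} → Circuit C → g ∈ C → f ∉ C →
    ∃[ D ] Circuit D × f ∈ D × g ∉ D × Circuit C × C ⊆ (D - f) ∪ ⁅ g ⁆
  circuit-transfer f∈cl {C} C-circ g∈C f∉C
    with K , C-g⊆K , K-basis ← extend-to-basisOf (circuit⇒independent[C-x] C-circ g∈C)
                                 (λ y∈C-g → x∈p∧x≢y⇒x∈p-y ∈⊤ λ { refl → f∉C (x∈p-y⇒x∈p y∈C-g) })
    with D , D-circ , D⊆K∪f
           ← dependent⇒∃circuit (∈cl⇒dependent K-basis f∈cl λ f∈K → x∈p-y⇒x≢y (included K-basis f∈K) refl)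
    = D , D-circ , f∈D , g∉D , C-circ , C⊆D-f∪g
    where
    K-ind : Independent K
    K-ind = independent K-basis
    C⊆K∪g : C ⊆ K ∪ ⁅ g ⁆
    C⊆K∪g = subst (_⊆ K ∪ ⁅ g ⁆) (p-x∪⁅x⁆≡p C g∈C) (p⊆q⇒p∪⁅x⁆⊆q∪⁅x⁆ C-g⊆K)
    g∉K : g ∉ K
    g∉K g∈K = circuit⇒dependent C-circ (indep-⊆ (p⊆q∧x∈q⇒p∪⁅x⁆⊆q (λ k∈K → k∈K) g∈K ∘ C⊆K∪g) K-ind)
    f∈D : f ∈ D
    f∈D = circuit⊆I∪⁅x⁆⇒x∈C K-ind D-circ D⊆K∪f
    g∉D : g ∉ D
    g∉D = x∉p∪⁅y⁆ g∉K g≢f ∘ D⊆K∪f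
    -- D - f ⊆ K, so any circuit of the dependent set (D - f) ∪ {g} is the circuit C of K ∪ {g}.
    C⊆D-f∪g : C ⊆ (D - f) ∪ ⁅ g ⁆
    C⊆D-f∪g with C′ , C′-circ , C′⊆ ← dependent⇒∃circuit (freer⇒dependent D-circ f∈D g∉D) =
      subst (_⊆ (D - f) ∪ ⁅ g ⁆)
        (sym (circuit-unique K-ind g∉K C-circ C′-circ C⊆K∪g (p⊆q⇒p∪⁅x⁆⊆q∪⁅x⁆ (p⊆q∪⁅x⁆⇒p-x⊆q D⊆K∪f) ∘ C′⊆)))
        C′⊆

  basis-count-≤ : b M g ≤ b M f
  basis-count-≤ = count∋-≤ (λ X Y → X ≡ (Y - f) ∪ ⁅ g ⁆) (λ { _ _ _ refl refl → refl }) basis-transfer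

  flat-count-≤ : ¬ IsLoop M g → (q : ℕ → Bool) →
    count∋ (λ F → isFlat M F ∧ q (rank M F)) g ≤ count∋ (λ F → isFlat M F ∧ q (rank M F)) f
  flat-count-≤ ¬loop q = count∋-≤ (λ F Y → F ≡ cl M ((Y - f) ∪ ⁅ g ⁆)) (λ { _ _ _ refl refl → refl }) transfer
    where
    transfer : ∀ {F} → T (isFlat M F ∧ q (rank M F)) → g ∈ F → f ∉ F →
      ∃[ Y ] T (isFlat M Y ∧ q (rank M Y)) × f ∈ Y × g ∉ Y × F ≡ cl M ((Y - f) ∪ ⁅ g ⁆)
    transfer {F} F∈ g∈F f∉F =
      let F-flat , qF = Equivalence.to (T-∧ {isFlat M F}) F∈
          Y , Y-flat , rank-Y , f∈Y , g∉Y , F≡ = flat-transfer (¬loop⇒independent ¬loop) F-flat g∈F f∉F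
      in Y , Equivalence.from (T-∧ {isFlat M Y}) (Y-flat , subst (T ∘ q) (sym rank-Y) qF) , f∈Y , g∉Y , F≡

  circuit-count-≤ : ¬ IsColoop M f → γ M g ≤ γ M f
  circuit-count-≤ ¬coloop =
    count∋-≤ (λ C D → Circuit C × C ⊆ (D - f) ∪ ⁅ g ⁆) recovered (circuit-transfer (¬coloop⇒x∈cl[⊤-x] ¬coloop))
    where
    recovered : ∀ {C₁ C₂ D} → Circuit D → f ∈ D → g ∉ D →
      Circuit C₁ × C₁ ⊆ (D - f) ∪ ⁅ g ⁆ → Circuit C₂ × C₂ ⊆ (D - f) ∪ ⁅ g ⁆ → C₁ ≡ C₂
    recovered D-circ f∈D g∉D (C₁-circ , C₁⊆) (C₂-circ , C₂⊆) =
      circuit-unique (circuit⇒independent[C-x] D-circ f∈D) (g∉D ∘ x∈p-y⇒x∈p) C₁-circ C₂-circ C₁⊆ C₂⊆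

corollary8 : ∀ {n} (M : Matroid n) (f g : Fin n) → f ≢ g → Freer M f g →
    (b M f ≥ b M g)
    × (¬ IsLoop M g → ∀ (k : ℕ) → W M k f ≥ W M k g)
    × (¬ IsLoop M g → h M f ≥ h M g)
    × (¬ IsColoop M f → γ M f ≥ γ M g)
corollary8 M f g f≢g f-freer =
    basis-count-≤
  , (λ ¬loop k → subst₂ _≤_ (sym (W≡count∋ k g)) (sym (W≡count∋ k f)) (flat-count-≤ ¬loop (_≡ᵇ k)))
  , (λ ¬loop → flat-count-≤ ¬loop (λ m → suc m ≡ᵇ r M))
  , circuit-count-≤
  where
  open FreerProperties M f≢g f-freer
  W≡count∋ : ∀ k e → W M k e ≡ count∋ (λ F → isFlat M F ∧ (rank M F ≡ᵇ k)) e
  W≡count∋ k e = countSubsets-cong (λ F → sym (∧-assoc (isFlat M F) (rank M F ≡ᵇ k) (lookup F e)))
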